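{- For a positive integer $k$, let $H_k$ be the graph obtained as follows: for every $i\in\{1,\dots,k\}$ take two vertices $u_i,v_i$ and a $(u_i,v_i)$-path of length $4$ (with three new internal vertices, the paths being internally disjoint); then make $u_1,\dots,u_k$ pairwise adjacent and make $v_1,\dots,v_k$ pairwise adjacent. Then $H_k$ has $n=5k$ vertices and at least $4^k=4^{n/5}\ge 1.3195^n$ minimal matching cuts.
   Context: A matching cut of a graph $G$ is a (possibly empty) edge set $M$ that is a matching and equals $E(A,B)$, the set of edges between $A$ and $B$, for some partition $\{A,B\}$ of $V(G)$. A matching cut $M$ is minimal if no matching cut of $G$ is a proper subset of $M$. -}

module Defs where

open import Data.Nat using (ℕ; zero; suc; _*_; _^_; _≤_)
open import Data.Fin using (Fin; toℕ; remQuot) renaming (zero to 0F)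
open import Data.Fin.Patterns using (4F)
open import Data.Bool using (Bool; true; false)
open import Data.Product using (Σ; ∃; ∃-syntax; _×_; _,_)
open import Data.Sum using (_⊎_)
open import Relation.Binary.PropositionalEquality using (_≡_; _≢_)
open import Relation.Nullary using (¬_)
open import Function.Bundles using (_⇔_)

record Graph : Set₁ where
  field
    n   : ℕ
    Adj : Fin n → Fin n → Set

open Graph public

-- A set of edges of G, represented as a Boolean predicate on ordered vertex pairs:
-- the edge {x,y} belongs to M iff M x y ≡ true.
EdgeSet : Graph → Set
EdgeSet G = Fin (n G) → Fin (n G) → Bool

-- A partition {A,B} of V(G) with A, B nonempty, encoded by f (A = f⁻¹ true, B = f⁻¹ false).
IsPartition : (G : Graph) → (Fin (n G) → Bool) → Set
IsPartition G f = (∃[ a ] f a ≡ true) × (∃[ b ] f b ≡ false)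

IsCutOf : (G : Graph) → EdgeSet G → (Fin (n G) → Bool) → Set
IsCutOf G M f = ∀ x y → (M x y ≡ true) ⇔ (Adj G x y × (f x ≢ f y))

IsMatching : (G : Graph) → EdgeSet G → Set
IsMatching G M =
  (∀ x y → M x y ≡ true → Adj G x y) ×
  (∀ x y z → M x y ≡ true → M x z ≡ true → y ≡ z)

IsMatchingCut : (G : Graph) → EdgeSet G → Set
IsMatchingCut G M = IsMatching G M × (∃[ f ] (IsPartition G f × IsCutOf G M f))

_⊆ₑ_ : {G : Graph} → EdgeSet G → EdgeSet G → Set
M' ⊆ₑ M = ∀ x y → M' x y ≡ true → M x y ≡ true

_⊂ₑ_ : {G : Graph} → EdgeSet G → EdgeSet G → Set
_⊂ₑ_ {G} M' M = (_⊆ₑ_ {G} M' M) × (∃[ x ] ∃[ y ] (M x y ≡ true × M' x y ≡ false))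

IsMinimalMatchingCut : (G : Graph) → EdgeSet G → Set
IsMinimalMatchingCut G M =
  IsMatchingCut G M × (∀ (M' : EdgeSet G) → IsMatchingCut G M' → ¬ (_⊂ₑ_ {G} M' M))

Distinct : {G : Graph} → EdgeSet G → EdgeSet G → Set
Distinct M M' = ∃[ x ] ∃[ y ] (M x y ≢ M' x y)

AtLeastMinMatchingCuts : Graph → ℕ → Set
AtLeastMinMatchingCuts G N =
  Σ (Fin N → EdgeSet G) λ Ms →
    (∀ i → IsMinimalMatchingCut G (Ms i)) × (∀ i j → i ≢ j → Distinct {G} (Ms i) (Ms j))

-- Vertex (i , a) ∈ Fin k × Fin 5 (encoded in Fin (k * 5) via remQuot):
-- a = 0 is u_i, a = 4 is v_i, a = 1,2,3 are the internal vertices of the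
-- (u_i,v_i)-path u_i - (i,1) - (i,2) - (i,3) - v_i of length 4.
HAdj' : {k : ℕ} → Fin k × Fin 5 → Fin k × Fin 5 → Set
HAdj' (i , a) (j , b) =
  (i ≡ j × (toℕ a ≡ suc (toℕ b) ⊎ toℕ b ≡ suc (toℕ a))) ⊎
  (i ≢ j × ((a ≡ 0F × b ≡ 0F) ⊎ (a ≡ 4F × b ≡ 4F)))

H : ℕ → Graph
H k = record { n = k * 5 ; Adj = λ x y → HAdj' {k} (remQuot {k} 5 x) (remQuot {k} 5 y) }

-- A choice c : Fin k → Fin 4 of one edge on each path of H_k gives the partition in which
-- A contains, on path i, the vertices before the chosen edge; so A ∋ u_i and B ∋ v_i for
-- all i, and E(A,B) is exactly the k chosen edges, a matching. As the u_i and the v_i form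
-- cliques, A and B induce connected subgraphs. Hence for a cut E(A',B') ⊂ E(A,B), every
-- edge inside A or B, and a chosen edge missing from E(A',B'), lies inside A' or B'; this
-- joins everything into one class, so A' or B' is empty. Different choices differ in the
-- chosen edge of some path, which gives 4^k distinct minimal matching cuts.
module Submission where

open import Defs
open import Data.Nat using (ℕ; zero; suc; _+_; _*_; _^_; _≤_; _<_; z≤n; _≤?_; NonZero; >-nonZero⁻¹)
import Data.Nat.Properties as ℕP
open import Data.Nat.Tactic.RingSolver using (solve-∀)
open import Data.Fin using (Fin; toℕ; remQuot; combine; inject₁; funToFin; finToFun; fromℕ<)
  renaming (zero to 0F; suc to sucF)
open import Data.Fin.Patterns using (1F; 2F; 3F; 4F)
import Data.Fin.Properties as FP
open import Data.Bool using (Bool; true; false; _∧_; _xor_; if_then_else_)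
open import Data.Bool.Properties using (¬-not) renaming (_≟_ to _≟ᵇ_)
open import Data.Product using (_×_; Σ-syntax; _,_; proj₁; proj₂; uncurry)
open import Data.Sum using (inj₁; inj₂)
open import Function using (_∘_)
open import Function.Bundles using (mk⇔; Equivalence)
open import Relation.Binary.Definitions using (tri<; tri≈; tri>)
open import Relation.Binary.PropositionalEquality
  using (_≡_; _≢_; refl; sym; trans; cong; cong₂; subst; subst₂; module ≡-Reasoning)
open import Relation.Nullary using (¬_; Dec; yes; no; does; contradiction)
open import Relation.Nullary.Decidable
  using (dec-true; dec-false; decidable-stable; _×-dec_; _⊎-dec_; ¬?)

open Equivalence using (to; from)

module _ (G : Graph) where

  private
    V = Fin (n G)

  cut-sameSide : ∀ {M f} → IsCutOf G M f → ∀ {x y} → Adj G x y → M x y ≡ false → f x ≡ f y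
  cut-sameSide {f = f} cut {x} {y} xy Mxy =
    decidable-stable (f x ≟ᵇ f y)
      (λ fx≢fy → contradiction (trans (sym (from (cut x y) (xy , fx≢fy))) Mxy) λ ())

  cut-isMatching : ∀ {M f} → IsCutOf G M f → (partner : V → V) →
                   (∀ x y → Adj G x y → f x ≢ f y → y ≡ partner x) → IsMatching G M
  cut-isMatching {M} cut partner unique =
      (λ x y → proj₁ ∘ to (cut x y))
    , λ x y z Mxy Mxz → trans (edge⇒partner x y Mxy) (sym (edge⇒partner x z Mxz))
    where
    edge⇒partner : ∀ x y → M x y ≡ true → y ≡ partner x
    edge⇒partner x y Mxy = uncurry (unique x y) (to (cut x y) Mxy)

  -- G[A] and G[B] are connected, where A = f⁻¹ true and B = f⁻¹ false.
  SidesConnected : (V → Bool) → Set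
  SidesConnected f = ∀ (g : V → Bool) → (∀ x y → Adj G x y → f x ≡ f y → g x ≡ g y) →
                     ∀ x y → f x ≡ f y → g x ≡ g y

  sidesConnected⇒noSmallerCut :
    ∀ {M f} → IsCutOf G M f → SidesConnected f →
    ∀ {M' f'} → IsPartition G f' → IsCutOf G M' f' → ¬ (_⊂ₑ_ {G} M' M)
  sidesConnected⇒noSmallerCut {f = f} cut connected {f' = f'} ((a , f'a) , (b , f'b)) cut'
                               (M'⊆M , x , y , Mxy , M'xy) =
    contradiction (trans (sym f'a) (trans (f'-constant a b) f'b)) λ ()
    where
    xy : Adj G x y × f x ≢ f y
    xy = to (cut x y) Mxy

    f'-respects : ∀ u v → Adj G u v → f u ≡ f v → f' u ≡ f' v
    f'-respects u v uv fu≡fv = cut-sameSide cut' uv (¬-not (λ M'uv →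
      proj₂ (to (cut u v) (M'⊆M u v M'uv)) fu≡fv))

    f'-sides : ∀ u v → f u ≡ f v → f' u ≡ f' v
    f'-sides = connected f' f'-respects

    f'x≡f'y : f' x ≡ f' y
    f'x≡f'y = cut-sameSide cut' (proj₁ xy) M'xy

    f'≡f'x : ∀ z → f' z ≡ f' x
    f'≡f'x z with f z ≟ᵇ f x
    ... | yes fz≡fx = f'-sides z x fz≡fx
    ... | no fz≢fx  = trans (f'-sides z y (trans (¬-not fz≢fx) (sym (¬-not (proj₂ xy ∘ sym)))))
                            (sym f'x≡f'y)

    f'-constant : ∀ u v → f' u ≡ f' v
    f'-constant u v = trans (f'≡f'x u) (sym (f'≡f'x v))

  module _ (adj? : ∀ x y → Dec (Adj G x y)) where

    crossingEdges : (V → Bool) → EdgeSet G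
    crossingEdges f x y = does (adj? x y) ∧ (f x xor f y)

    crossingEdges-isCut : ∀ f → IsCutOf G (crossingEdges f) f
    crossingEdges-isCut f x y = mk⇔ (⇒ (adj? x y) (f x) (f y)) (⇐ (adj? x y) (f x) (f y))
      where
      ⇒ : ∀ {P : Set} (P? : Dec P) s t → does P? ∧ (s xor t) ≡ true → P × s ≢ t
      ⇒ (yes p) true  false _ = p , λ ()
      ⇒ (yes p) false true  _ = p , λ ()
      ⇒ (yes p) true  true  ()
      ⇒ (yes p) false false ()
      ⇒ (no _)  _     _     ()

      ⇐ : ∀ {P : Set} (P? : Dec P) s t → P × s ≢ t → does P? ∧ (s xor t) ≡ true
      ⇐ (no ¬p) _     _     (p , _)    = contradiction p ¬p
      ⇐ (yes _) true  false _          = refl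
      ⇐ (yes _) false true  _          = refl
      ⇐ (yes _) true  true  (_ , s≢t)  = contradiction refl s≢t
      ⇐ (yes _) false false (_ , s≢t)  = contradiction refl s≢t

    crossingEdges-sameSide : ∀ f {x y} → f x ≡ f y → crossingEdges f x y ≡ false
    crossingEdges-sameSide f {x} {y} fx≡fy =
      ¬-not λ E → proj₂ (to (crossingEdges-isCut f x y) E) fx≡fy

funToFin-cong : ∀ {k m} {c c' : Fin k → Fin m} → (∀ i → c i ≡ c' i) → funToFin c ≡ funToFin c'
funToFin-cong {zero}  _ = refl
funToFin-cong {suc k} c≗c' = cong₂ combine (c≗c' 0F) (funToFin-cong (c≗c' ∘ sucF))

finToFun-injective : ∀ {k m} {e e' : Fin (m ^ k)} →
                     (∀ (i : Fin k) → finToFun {m} e i ≡ finToFun e' i) → e ≡ e'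
finToFun-injective {k} {m} {e} {e'} e≗e' = begin
  e                  ≡⟨ FP.funToFin-finToFin {k} {m} e ⟨
  encode (decode e)  ≡⟨ funToFin-cong e≗e' ⟩
  encode (decode e') ≡⟨ FP.funToFin-finToFin {k} {m} e' ⟩
  e'                 ∎
  where
  open ≡-Reasoning
  decode = finToFun {m} {k}
  encode = funToFin {k} {m}

finToFun-separates : ∀ {k m} {e e' : Fin (m ^ k)} → e ≢ e' →
                     Σ[ i ∈ Fin k ] finToFun {m} e i ≢ finToFun e' i
finToFun-separates {k} {m} {e} {e'} e≢e' =
  FP.¬∀⟶∃¬ k _ (λ i → finToFun e i FP.≟ finToFun e' i) (e≢e' ∘ finToFun-injective {k} {m})

^-bound : ∀ {a b c m} → a ^ m ≤ b * c ^ m → ∀ k → a ^ (k * m) ≤ b ^ k * c ^ (k * m)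
^-bound             _    zero    = ℕP.≤-refl
^-bound {a} {b} {c} {m} base (suc k) = begin
  a ^ (m + k * m)                       ≡⟨ ℕP.^-distribˡ-+-* a m (k * m) ⟩
  a ^ m * a ^ (k * m)                   ≤⟨ ℕP.*-mono-≤ base (^-bound base k) ⟩
  b * c ^ m * (b ^ k * c ^ (k * m))     ≡⟨ interchange b (c ^ m) (b ^ k) (c ^ (k * m)) ⟩
  b * b ^ k * (c ^ m * c ^ (k * m))     ≡⟨ cong (b ^ suc k *_) (ℕP.^-distribˡ-+-* c m (k * m)) ⟨
  b ^ suc k * c ^ (m + k * m)           ∎
  where
  open ℕP.≤-Reasoning
  interchange : ∀ w x y z → w * x * (y * z) ≡ w * y * (x * z)
  interchange = solve-∀

HAdj'? : ∀ {k} (p q : Fin k × Fin 5) → Dec (HAdj' p q)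
HAdj'? (i , a) (j , b) =
  ((i FP.≟ j) ×-dec ((toℕ a ℕP.≟ suc (toℕ b)) ⊎-dec (toℕ b ℕP.≟ suc (toℕ a)))) ⊎-dec
  (¬? (i FP.≟ j) ×-dec (((a FP.≟ 0F) ×-dec (b FP.≟ 0F)) ⊎-dec ((a FP.≟ 4F) ×-dec (b FP.≟ 4F))))

module Coordinates (k : ℕ) where

  coord : Fin (k * 5) → Fin k × Fin 5
  coord = remQuot 5

  vertex : Fin k × Fin 5 → Fin (k * 5)
  vertex = uncurry combine

  coord-vertex : ∀ p → coord (vertex p) ≡ p
  coord-vertex (i , a) = FP.remQuot-combine i a

  vertex-coord : ∀ x → vertex (coord x) ≡ x
  vertex-coord = FP.combine-remQuot {k} 5

  adj? : ∀ x y → Dec (Adj (H k) x y)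
  adj? x y = HAdj'? (coord x) (coord y)

  adj-vertex : ∀ {p q} → HAdj' p q → Adj (H k) (vertex p) (vertex q)
  adj-vertex {p} {q} = subst₂ HAdj' (sym (coord-vertex p)) (sym (coord-vertex q))

toℕ≡⇒≡inject₁ : ∀ {m} (r : Fin m) (b : Fin (suc m)) → toℕ r ≡ toℕ b → b ≡ inject₁ r
toℕ≡⇒≡inject₁ r b r≡b = FP.toℕ-injective (trans (sym r≡b) (sym (FP.toℕ-inject₁ r)))

-- Edge b of path i joins (i , inject₁ b) and (i , suc b); the cut uses edge c i of path i.
module ChoiceCut (k : ℕ) (c : Fin k → Fin 4) where

  open Coordinates k

  rung : ∀ (i : Fin k) (b : Fin 4) → HAdj' (i , inject₁ b) (i , sucF b)
  rung i b = inj₁ (refl , inj₂ (cong suc (sym (FP.toℕ-inject₁ b))))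

  side : Fin k × Fin 5 → Bool
  side (i , a) = does (toℕ a ≤? toℕ (c i))

  side-true : ∀ i a → toℕ a ≤ toℕ (c i) → side (i , a) ≡ true
  side-true i a = dec-true (toℕ a ≤? toℕ (c i))

  side-false : ∀ i a → toℕ (c i) < toℕ a → side (i , a) ≡ false
  side-false i a = dec-false (toℕ a ≤? toℕ (c i)) ∘ ℕP.<⇒≱

  u-side : ∀ i → side (i , 0F) ≡ true
  u-side i = side-true i 0F z≤n

  v-side : ∀ i → side (i , 4F) ≡ false
  v-side i = side-false i 4F (FP.toℕ<n (c i))

  chosen-lower-side : ∀ i → side (i , inject₁ (c i)) ≡ true
  chosen-lower-side i = side-true i (inject₁ (c i)) (ℕP.≤-reflexive (FP.toℕ-inject₁ (c i)))

  chosen-upper-side : ∀ i → side (i , sucF (c i)) ≡ false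
  chosen-upper-side i = side-false i (sucF (c i)) (ℕP.n<1+n (toℕ (c i)))

  rung-sameSide : ∀ i b → b ≢ c i → side (i , inject₁ b) ≡ side (i , sucF b)
  rung-sameSide i b b≢cᵢ with ℕP.<-cmp (toℕ b) (toℕ (c i))
  ... | tri< b<cᵢ _ _ =
    trans (side-true i (inject₁ b) (ℕP.≤-trans (ℕP.≤-reflexive (FP.toℕ-inject₁ b)) (ℕP.<⇒≤ b<cᵢ)))
          (sym (side-true i (sucF b) b<cᵢ))
  ... | tri≈ _ b≡cᵢ _ = contradiction (FP.toℕ-injective b≡cᵢ) b≢cᵢ
  ... | tri> _ _ cᵢ<b =
    trans (side-false i (inject₁ b) (subst (toℕ (c i) <_) (sym (FP.toℕ-inject₁ b)) cᵢ<b))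
          (sym (side-false i (sucF b) (ℕP.m<n⇒m<1+n cᵢ<b)))

  partner : Fin k × Fin 5 → Fin k × Fin 5
  partner (i , a) = i , (if side (i , a) then sucF (c i) else inject₁ (c i))

  crossing⇒partner : ∀ p q → HAdj' p q → side p ≢ side q → q ≡ partner p
  crossing⇒partner (_ , 0F) _ (inj₁ (refl , inj₁ ()))
  crossing⇒partner _ (_ , 0F) (inj₁ (refl , inj₂ ()))
  crossing⇒partner (i , sucF r) (.i , b) (inj₁ (refl , inj₁ r≡b)) ≢side
    with refl ← toℕ≡⇒≡inject₁ r b (ℕP.suc-injective r≡b) | r FP.≟ c i
  ... | no r≢cᵢ  = contradiction (sym (rung-sameSide i r r≢cᵢ)) ≢side
  ... | yes refl rewrite chosen-upper-side i = refl
  crossing⇒partner (i , a) (.i , sucF r) (inj₁ (refl , inj₂ r≡a)) ≢side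
    with refl ← toℕ≡⇒≡inject₁ r a (ℕP.suc-injective r≡a) | r FP.≟ c i
  ... | no r≢cᵢ  = contradiction (rung-sameSide i r r≢cᵢ) ≢side
  ... | yes refl rewrite chosen-lower-side i = refl
  crossing⇒partner (i , _) (j , _) (inj₂ (_ , inj₁ (refl , refl))) ≢side =
    contradiction (trans (u-side i) (sym (u-side j))) ≢side
  crossing⇒partner (i , _) (j , _) (inj₂ (_ , inj₂ (refl , refl))) ≢side =
    contradiction (trans (v-side i) (sym (v-side j))) ≢side

  side-vertex : ∀ p → side (coord (vertex p)) ≡ side p
  side-vertex p = cong side (coord-vertex p)

  cut : EdgeSet (H k)
  cut = crossingEdges (H k) adj? (side ∘ coord)

  isCut : IsCutOf (H k) cut (side ∘ coord)
  isCut = crossingEdges-isCut (H k) adj? (side ∘ coord)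

  chosenRung∈cut : ∀ i → cut (vertex (i , inject₁ (c i))) (vertex (i , sucF (c i))) ≡ true
  chosenRung∈cut i = from (isCut _ _) (adj-vertex (rung i (c i)) , λ ≡side →
    contradiction (trans (sym (trans (side-vertex _) (chosen-lower-side i)))
                         (trans ≡side (trans (side-vertex _) (chosen-upper-side i)))) λ ())

  otherRung∉cut : ∀ i b → b ≢ c i → cut (vertex (i , inject₁ b)) (vertex (i , sucF b)) ≡ false
  otherRung∉cut i b b≢cᵢ = crossingEdges-sameSide (H k) adj? (side ∘ coord)
    (trans (side-vertex _) (trans (rung-sameSide i b b≢cᵢ) (sym (side-vertex _))))

  isMatching : IsMatching (H k) cut
  isMatching = cut-isMatching (H k) isCut (vertex ∘ partner ∘ coord)
    λ x y xy ≢side → trans (sym (vertex-coord y))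
                           (cong vertex (crossing⇒partner (coord x) (coord y) xy ≢side))

  sidesConnected : SidesConnected (H k) (side ∘ coord)
  sidesConnected g respects x y ≡side = begin
    g x                                ≡⟨ cong g (vertex-coord x) ⟨
    g (vertex (coord x))               ≡⟨ ≡anchor (coord x) ⟩
    anchor j (side (coord x))          ≡⟨ cong (anchor j) ≡side ⟩
    anchor j (side (coord y))          ≡⟨ ≡anchor (coord y) ⟨
    g (vertex (coord y))               ≡⟨ cong g (vertex-coord y) ⟩
    g y                                ∎
    where
    open ≡-Reasoning
    j = proj₁ (coord x)

    g' : Fin k × Fin 5 → Bool
    g' = g ∘ vertex

    respects' : ∀ p q → HAdj' p q → side p ≡ side q → g' p ≡ g' q
    respects' p q pq ≡side = respects (vertex p) (vertex q) (adj-vertex pq)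
      (trans (side-vertex p) (trans ≡side (sym (side-vertex q))))

    along : ∀ i b → b ≢ c i → g' (i , inject₁ b) ≡ g' (i , sucF b)
    along i b b≢cᵢ = respects' (i , inject₁ b) (i , sucF b) (rung i b) (rung-sameSide i b b≢cᵢ)

    along< : ∀ i b → toℕ b < toℕ (c i) → g' (i , sucF b) ≡ g' (i , inject₁ b)
    along< i b b<cᵢ = sym (along i b (ℕP.<⇒≢ b<cᵢ ∘ cong toℕ))

    along> : ∀ i b → toℕ (c i) < toℕ b → g' (i , inject₁ b) ≡ g' (i , sucF b)
    along> i b cᵢ<b = along i b (ℕP.<⇒≢ cᵢ<b ∘ sym ∘ cong toℕ)

    down : ∀ i a → toℕ a ≤ toℕ (c i) → g' (i , a) ≡ g' (i , 0F)
    down i 0F _ = refl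
    down i 1F h = along< i 0F h
    down i 2F h = trans (along< i 1F h) (along< i 0F (ℕP.<⇒≤ h))
    down i 3F h =
      trans (along< i 2F h) (trans (along< i 1F (ℕP.<⇒≤ h)) (along< i 0F (ℕP.<⇒≤ (ℕP.<⇒≤ h))))
    down i 4F h = contradiction (FP.toℕ<n (c i)) (ℕP.≤⇒≯ h)

    up : ∀ i a → toℕ (c i) < toℕ a → g' (i , a) ≡ g' (i , 4F)
    up i 0F ()
    up i 1F h = trans (along> i 1F h) (trans (along> i 2F h′) (along> i 3F (ℕP.m<n⇒m<1+n h′)))
      where h′ = ℕP.m<n⇒m<1+n h
    up i 2F h = trans (along> i 2F h) (along> i 3F (ℕP.m<n⇒m<1+n h))
    up i 3F h = along> i 3F h
    up i 4F _ = refl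

    u-clique : ∀ i → g' (i , 0F) ≡ g' (j , 0F)
    u-clique i with i FP.≟ j
    ... | yes refl = refl
    ... | no i≢j  = respects' (i , 0F) (j , 0F) (inj₂ (i≢j , inj₁ (refl , refl)))
                              (trans (u-side i) (sym (u-side j)))

    v-clique : ∀ i → g' (i , 4F) ≡ g' (j , 4F)
    v-clique i with i FP.≟ j
    ... | yes refl = refl
    ... | no i≢j  = respects' (i , 4F) (j , 4F) (inj₂ (i≢j , inj₂ (refl , refl)))
                              (trans (v-side i) (sym (v-side j)))

    anchor : Fin k → Bool → Bool
    anchor j true  = g' (j , 0F)
    anchor j false = g' (j , 4F)

    ≡anchor : ∀ p → g' p ≡ anchor j (side p)
    ≡anchor (i , a) with toℕ a ≤? toℕ (c i)
    ... | yes a≤cᵢ = trans (down i a a≤cᵢ)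
                           (trans (u-clique i) (cong (anchor j) (sym (side-true i a a≤cᵢ))))
    ... | no a≰cᵢ  = trans (up i a cᵢ<a)
                           (trans (v-clique i) (cong (anchor j) (sym (side-false i a cᵢ<a))))
      where cᵢ<a = ℕP.≰⇒> a≰cᵢ

  isMinimalMatchingCut : Fin k → IsMinimalMatchingCut (H k) cut
  isMinimalMatchingCut i =
      (isMatching , side ∘ coord , isPartition , isCut)
    , λ M' (_ , f' , f'-partition , M'-cut) →
        sidesConnected⇒noSmallerCut (H k) isCut sidesConnected f'-partition M'-cut
    where
    isPartition : IsPartition (H k) (side ∘ coord)
    isPartition = (vertex (i , 0F) , trans (side-vertex (i , 0F)) (u-side i))
                , (vertex (i , 4F) , trans (side-vertex (i , 4F)) (v-side i))

choiceCut-distinct : ∀ k {c c' : Fin k → Fin 4} i → c i ≢ c' i →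
                     Distinct {H k} (ChoiceCut.cut k c) (ChoiceCut.cut k c')
choiceCut-distinct k {c} {c'} i cᵢ≢c'ᵢ = vertex (i , inject₁ (c i)) , vertex (i , sucF (c i)) ,
  λ same → contradiction (trans (sym (ChoiceCut.chosenRung∈cut k c i))
                                (trans same (ChoiceCut.otherRung∉cut k c' i (c i) cᵢ≢c'ᵢ))) λ ()
  where open Coordinates k

proposition12 : (k : ℕ) → .{{_ : NonZero k}} →
    (n (H k) ≡ 5 * k) ×
    AtLeastMinMatchingCuts (H k) (4 ^ k) ×
    (13195 ^ n (H k) ≤ 4 ^ k * 10000 ^ n (H k))
proposition12 k =
  ℕP.*-comm k 5 , (cuts , minimal , distinct) , ^-bound (ℕP.≤ᵇ⇒≤ (13195 ^ 5) (4 * 10000 ^ 5) _) k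
  where
  cuts : Fin (4 ^ k) → EdgeSet (H k)
  cuts e = ChoiceCut.cut k (finToFun e)

  minimal : ∀ e → IsMinimalMatchingCut (H k) (cuts e)
  minimal e = ChoiceCut.isMinimalMatchingCut k (finToFun e) (fromℕ< (>-nonZero⁻¹ k))

  distinct : ∀ e e' → e ≢ e' → Distinct {H k} (cuts e) (cuts e')
  distinct e e' e≢e' = let (i , finToFun-differ) = finToFun-separates {k} {4} e≢e'
                       in choiceCut-distinct k {finToFun e} {finToFun e'} i finToFun-differ
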